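{- Let $S$ be a finite, independent, generating set in an abelian group $G$. If $A\subseteq G$ is finite, non-empty, and compressed with respect to $S$, then $$\frac1{|A|}\sum_{a\in A}w(a)\le\frac12\log_2|A|,$$ where $w(a)$ is the number of non-zero summands in the representation of $a$ as a linear combination of the elements of $S$.
   Context: Write $S=\{s_1,\dots,s_n\}$; independence and generation mean $G=\bigoplus_{i}\langle s_i\rangle$, so each $g\in G$ is uniquely $g=\sum_i z_is_i$ with $z_i\in K_i$, where $K_i:=[0,\operatorname{ord}(s_i))\cap\mathbb{Z}$ if $s_i$ has finite order and $K_i=\mathbb{Z}$ otherwise; $w(g)$ is the number of $i$ with $z_is_i\ne0$. With $S_i:=S\setminus\{s_i\}$, the compression along $s_i$ is $[A]_i:=\{g=h+ks_i: h\in\langle S_i\rangle, k\in K_i, 0\le k<|(g+\langle s_i\rangle)\cap A|\}$; $A$ is compressed with respect to $S$ if $[A]_i=A$ for every $i\in[1,n]$. -}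

module Defs where

open import Data.Nat as ℕ using (ℕ; zero; suc)
open import Data.Integer as ℤ using (ℤ; +_; 0ℤ)
open import Data.Fin using (Fin)
open import Data.Vec using (Vec; []; _∷_; lookup; _[_]≔_)
open import Data.Vec.Properties using (≡-dec)
open import Data.List using (List; length; filter)
open import Data.List.Membership.Propositional using (_∈_)
open import Data.Product using (_×_)
open import Data.Sum using (_⊎_)
open import Relation.Binary.PropositionalEquality using (_≡_)
open import Relation.Nullary using (does)
open import Data.Bool using (true; false)
import Data.List
import Data.Nat.ListAction

-- Model of G = ⊕_{i<n} ⟨s_i⟩ (S = {s_0,…,s_{n-1}} independent and generating).
-- The orders of the generators are given by  ord : Fin n → ℕ,
-- with the convention  ord i ≡ 0  meaning  s_i  has infinite order.
-- An element g = Σ z_i s_i is represented by its coordinate vector (z_i) : Vec ℤ n,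
-- with z_i ∈ K_i (see InK).

InK : ℕ → ℤ → Set
InK m z = m ≡ 0 ⊎ (0ℤ ℤ.≤ z × z ℤ.< + m)

Valid : {n : ℕ} → (Fin n → ℕ) → Vec ℤ n → Set
Valid {n} ord g = (i : Fin n) → InK (ord i) (lookup g i)

-- w(g): number of i with z_i s_i ≠ 0, i.e. z_i ≠ 0 (as z_i ∈ K_i).
weight : {n : ℕ} → Vec ℤ n → ℕ
weight [] = 0
weight (z ∷ g) with does (z ℤ.≟ 0ℤ)
... | true = weight g
... | false = suc (weight g)

-- a ∈ g + ⟨s_i⟩  iff  a and g agree in all coordinates except possibly the i-th.
-- |(g + ⟨s_i⟩) ∩ A|  for a duplicate-free list A.
fiberSize : {n : ℕ} → Fin n → Vec ℤ n → List (Vec ℤ n) → ℕ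
fiberSize i g A =
  length (filter (λ a → ≡-dec ℤ._≟_ (a [ i ]≔ 0ℤ) (g [ i ]≔ 0ℤ)) A)

-- g ∈ [A]_i  (for valid g = h + k s_i, h ∈ ⟨S_i⟩, k ∈ K_i the i-th coordinate):
-- 0 ≤ k < |(g + ⟨s_i⟩) ∩ A|.
InCompression : {n : ℕ} → Fin n → List (Vec ℤ n) → Vec ℤ n → Set
InCompression i A g = 0ℤ ℤ.≤ lookup g i × lookup g i ℤ.< + fiberSize i g A

Compressed : {n : ℕ} → (Fin n → ℕ) → List (Vec ℤ n) → Set
Compressed {n} ord A =
  (i : Fin n) (g : Vec ℤ n) → Valid ord g →
  ((g ∈ A → InCompression i A g) × (InCompression i A g → g ∈ A))

totalWeight : {n : ℕ} → List (Vec ℤ n) → ℕ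
totalWeight A = Data.Nat.ListAction.sum (Data.List.map weight A)

module Submission where

-- Points of G are coordinate vectors in ℤⁿ; write a − e_j for a with its j-th
-- coordinate lowered by one.  A down-edge of A is a pair (a, j) with a ∈ A and
-- a − e_j ∈ A; let E(A) be the number of down-edges.
--
-- (1) Compression:  if A is compressed and the j-th coordinate of a ∈ A is
--     nonzero, then a − e_j ∈ A (it lies in the same s_j-fibre, one step lower).
--     So w(a) is at most the number of down-edges at a, and Σ w ≤ E(A).
-- (2) Edge-isoperimetric inequality in ℤⁿ:  4^E(A) ≤ |A|^|A| for every finite A.
--     By strong induction on |A|: two distinct points differ in a coordinate i, and
--     a hyperplane x_i = t between them cuts A into nonempty halves L and U with
--     E(A) = E(L) + E(U) + c, where the c crossing edges satisfy c ≤ min(|L|,|U|).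
--     The induction closes by the numeric inequality
--     4^y · x^x · y^y ≤ (x+y)^(x+y) for y ≤ x, which follows from the monotonicity
--     of (1 + y/x)^x, itself a consequence of a Bernoulli-type estimate.

open import Defs
open import Data.Nat using (ℕ; zero; suc; _≤_; _<_; _^_; _*_; _+_; z≤n; s≤s; NonZero)
open import Data.Nat.Properties as ℕP using (≤-refl; ≤-trans; ≤-reflexive; +-mono-≤)
open import Data.Nat.ListAction using (sum)
open import Data.Nat.Tactic.RingSolver using (solve-∀)
open import Data.Integer as ℤ using (ℤ; 0ℤ)
import Data.Integer.Properties as ℤP
open import Data.Fin using (Fin; zero; suc; punchIn)
open import Data.Fin.Properties using (¬∀⟶∃¬; punchInᵢ≢i) renaming (_≟_ to _≟ᶠ_)
open import Data.Vec using (Vec; []; _∷_; lookup; _[_]≔_)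
open import Data.Vec.Properties
  using (≡-dec; lookup∘update; lookup∘update′; []≔-idempotent; []≔-lookup; tabulate∘lookup; tabulate-cong)
open import Data.List using (List; []; _∷_; length; filter; map; _++_)
open import Data.List.Properties using (filter-notAll)
open import Data.List.Relation.Unary.All as All using (All; _∷_)
open import Data.List.Relation.Unary.Any using (here; there)
open import Data.List.Relation.Unary.AllPairs using (_∷_)
open import Data.List.Relation.Unary.Unique.Propositional using (Unique)
import Data.List.Relation.Unary.Unique.Propositional.Properties as Unique
open import Data.List.Membership.Propositional using (_∈_; _∉_; lose)
open import Data.List.Membership.Propositional.Properties using (∈-filter⁺; ∈-filter⁻; ∈-∃++)
open import Data.List.Relation.Binary.Permutation.Propositional using (_↭_; ↭-sym)
open import Data.List.Relation.Binary.Permutation.Propositional.Properties using (shift; ∈-resp-↭; ↭-length)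
open import Algebra.Properties.CommutativeMonoid.Sum ℕP.+-0-commutativeMonoid
  using (∑-distrib-+; sum-cong-≗; sum-remove; sum-replicate-zero)
  renaming (sum to ∑)
open import Data.Product using (∃; _,_; proj₁; proj₂)
open import Data.Sum using (inj₁; inj₂)
open import Data.Unit using (tt)
open import Function using (_∘_; _⇔_; mk⇔; Equivalence)
open import Function.Definitions using (Injective)
open import Level using (0ℓ)
open import Relation.Nullary using (yes; no; ¬_; contradiction)
open import Relation.Unary using (Pred; Decidable)
open import Relation.Unary.Properties using (∁?)
open import Relation.Binary.Definitions using (DecidableEquality; tri<; tri≈; tri>)
open import Relation.Binary.PropositionalEquality

-- Numeric inequalities

^-distribʳ-* : ∀ m n k → (m * n) ^ k ≡ m ^ k * n ^ k
^-distribʳ-* m n zero = refl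
^-distribʳ-* m n (suc k) = begin
    m * n * (m * n) ^ k       ≡⟨ cong (m * n *_) (^-distribʳ-* m n k) ⟩
    m * n * (m ^ k * n ^ k)   ≡⟨ interchange m n (m ^ k) (n ^ k) ⟩
    m * m ^ k * (n * n ^ k)   ∎
  where
  open ≡-Reasoning
  interchange : ∀ m n p q → m * n * (p * q) ≡ m * p * (n * q)
  interchange = solve-∀

-- A Bernoulli-type upper estimate: (a+d)ⁿ − aⁿ ≤ n·d·(a+d)ⁿ⁻¹, multiplied by a+d.
powerGap : ∀ a d n → (a + d) ^ suc n ≤ (a + d) * a ^ n + n * d * (a + d) ^ n
powerGap a d zero = ℕP.m≤m+n _ 0
powerGap a d (suc n) = begin
    (a + d) * (a + d) ^ suc n
  ≤⟨ ℕP.*-monoʳ-≤ (a + d) (powerGap a d n) ⟩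
    (a + d) * ((a + d) * a ^ n + n * d * (a + d) ^ n)
  ≡⟨ expand a d (a ^ n) n ((a + d) ^ n) ⟩
    (a + d) * (a * a ^ n) + n * d * ((a + d) * (a + d) ^ n) + d * ((a + d) * a ^ n)
  ≤⟨ ℕP.+-monoʳ-≤ _ (ℕP.*-monoʳ-≤ d (ℕP.*-monoʳ-≤ (a + d) (ℕP.^-monoˡ-≤ n (ℕP.m≤m+n a d)))) ⟩
    (a + d) * (a * a ^ n) + n * d * ((a + d) * (a + d) ^ n) + d * ((a + d) * (a + d) ^ n)
  ≡⟨ collect ((a + d) * (a * a ^ n)) ((a + d) * (a + d) ^ n) n d ⟩
    (a + d) * (a * a ^ n) + suc n * d * ((a + d) * (a + d) ^ n)
  ∎
  where
  open ℕP.≤-Reasoning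
  expand : ∀ a d p n q →
    (a + d) * ((a + d) * p + n * d * q) ≡ (a + d) * (a * p) + n * d * ((a + d) * q) + d * ((a + d) * p)
  expand = solve-∀
  collect : ∀ x y n d → x + n * d * y + d * y ≡ x + suc n * d * y
  collect = solve-∀

-- Core of the monotonicity of (1 + y/x)^x: with a = x(x+1+y) and c = a + y = (x+1)(x+y),
-- (x+1)·cˣ ≤ (x+1+y)·aˣ.  It follows from powerGap after cancelling k = x² + x + y.
compoundStep : ∀ x y → suc x * (suc x * (x + y)) ^ x ≤ (suc x + y) * (x * (suc x + y)) ^ x
compoundStep zero y = s≤s z≤n
compoundStep x@(suc _) y = ℕP.*-cancelˡ-≤ k scaled
  where
  open ℕP.≤-Reasoning
  a c k : ℕ
  a = x * (suc x + y)
  c = suc x * (x + y)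
  k = x * x + x + y
  instance
    k-nonZero : NonZero k
    k-nonZero = record { nonZero = tt }
  a+y≡c : a + y ≡ c
  a+y≡c = identity x y
    where
    identity : ∀ x y → x * (suc x + y) + y ≡ suc x * (x + y)
    identity = solve-∀
  -- kcˣ ≤ caˣ, i.e. powerGap for (a + y)^(x+1) after subtracting x·y·cˣ.
  bernoulli : k * c ^ x ≤ c * a ^ x
  bernoulli = ℕP.+-cancelʳ-≤ (x * y * c ^ x) (k * c ^ x) (c * a ^ x) (begin
      k * c ^ x + x * y * c ^ x   ≡⟨ regroup x y (c ^ x) ⟩
      c * c ^ x                   ≤⟨ subst (λ s → s * s ^ x ≤ s * a ^ x + x * y * s ^ x) a+y≡c (powerGap a y x) ⟩
      c * a ^ x + x * y * c ^ x   ∎)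
    where
    regroup : ∀ x y Z → (x * x + x + y) * Z + x * y * Z ≡ suc x * (x + y) * Z
    regroup = solve-∀
  scaled : k * (suc x * c ^ x) ≤ k * ((suc x + y) * a ^ x)
  scaled = begin
      k * (suc x * c ^ x)                   ≡⟨ swap k (suc x) (c ^ x) ⟩
      suc x * (k * c ^ x)                   ≤⟨ ℕP.*-monoʳ-≤ (suc x) bernoulli ⟩
      suc x * (c * a ^ x)                   ≤⟨ ℕP.m≤m+n _ (y * y * a ^ x) ⟩
      suc x * (c * a ^ x) + y * y * a ^ x   ≡⟨ factor x y (a ^ x) ⟩
      k * ((suc x + y) * a ^ x)             ∎
    where
    swap : ∀ k s Z → k * (s * Z) ≡ s * (k * Z)
    swap = solve-∀
    factor : ∀ x y Q → suc x * (suc x * (x + y) * Q) + y * y * Q ≡ (x * x + x + y) * ((suc x + y) * Q)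
    factor = solve-∀

-- (1 + y/x)^x is nondecreasing in x:  (x+y)^x·(x+1)^(x+1) ≤ (x+1+y)^(x+1)·x^x.
compoundMono : ∀ x y → (x + y) ^ x * suc x ^ suc x ≤ (suc x + y) ^ suc x * x ^ x
compoundMono x y = begin
    (x + y) ^ x * suc x ^ suc x
  ≡⟨ rotate ((x + y) ^ x) (suc x) (suc x ^ x) ⟩
    suc x * (suc x ^ x * (x + y) ^ x)
  ≡⟨ cong (suc x *_) (sym (^-distribʳ-* (suc x) (x + y) x)) ⟩
    suc x * (suc x * (x + y)) ^ x
  ≤⟨ compoundStep x y ⟩
    (suc x + y) * (x * (suc x + y)) ^ x
  ≡⟨ cong ((suc x + y) *_) (^-distribʳ-* x (suc x + y) x) ⟩
    (suc x + y) * (x ^ x * (suc x + y) ^ x)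
  ≡⟨ reassociate (suc x + y) (x ^ x) ((suc x + y) ^ x) ⟩
    (suc x + y) ^ suc x * x ^ x
  ∎
  where
  open ℕP.≤-Reasoning
  rotate : ∀ p s q → p * (s * q) ≡ s * (q * p)
  rotate = solve-∀
  reassociate : ∀ s q p → s * (q * p) ≡ s * p * q
  reassociate = solve-∀

-- n^n ≥ 1 (with 0^0 = 1), so n^n may be cancelled from an inequality.
selfPow-nonZero : ∀ n → NonZero (n ^ n)
selfPow-nonZero zero = record { nonZero = tt }
selfPow-nonZero (suc n) = ℕP.m^n≢0 (suc n) (suc n)

-- For X ≥ y, (1 + y/X)^X is at least its value 2^y at X = y:  2^y·X^X ≤ (X+y)^X,
-- written with X = k + y.
twoPowBound : ∀ y k → 2 ^ y * (k + y) ^ (k + y) ≤ (k + y + y) ^ (k + y)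
twoPowBound y zero = ≤-reflexive (trans (sym (^-distribʳ-* 2 y y)) (cong (_^ y) (double y)))
  where
  double : ∀ y → 2 * y ≡ y + y
  double = solve-∀
twoPowBound y (suc k) = ℕP.*-cancelˡ-≤ (X ^ X) {{selfPow-nonZero X}} (begin
    X ^ X * (2 ^ y * suc X ^ suc X)   ≡⟨ regroup (X ^ X) (2 ^ y) (suc X ^ suc X) ⟩
    2 ^ y * X ^ X * suc X ^ suc X     ≤⟨ ℕP.*-monoˡ-≤ (suc X ^ suc X) (twoPowBound y k) ⟩
    (X + y) ^ X * suc X ^ suc X       ≤⟨ compoundMono X y ⟩
    (suc X + y) ^ suc X * X ^ X       ≡⟨ ℕP.*-comm ((suc X + y) ^ suc X) (X ^ X) ⟩
    X ^ X * (suc X + y) ^ suc X       ∎)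
  where
  open ℕP.≤-Reasoning
  X : ℕ
  X = k + y
  regroup : ∀ p q r → p * (q * r) ≡ q * p * r
  regroup = solve-∀

fourPowBound : ∀ x y → y ≤ x → 4 ^ y * (x ^ x * y ^ y) ≤ (x + y) ^ (x + y)
fourPowBound x y y≤x with k , refl ← ℕP.m≤n⇒∃[o]m+o≡n y≤x
  rewrite ℕP.+-comm y k = begin
    4 ^ y * (X ^ X * y ^ y)
  ≡⟨ cong (_* (X ^ X * y ^ y)) (^-distribʳ-* 2 2 y) ⟩
    2 ^ y * 2 ^ y * (X ^ X * y ^ y)
  ≡⟨ interchange (2 ^ y) (X ^ X) (y ^ y) ⟩
    2 ^ y * X ^ X * (2 ^ y * y ^ y)
  ≤⟨ ℕP.*-mono-≤ (twoPowBound y k) (≤-reflexive (trans (sym (^-distribʳ-* 2 y y)) (cong (_^ y) (double y)))) ⟩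
    (X + y) ^ X * (y + y) ^ y
  ≤⟨ ℕP.*-monoʳ-≤ ((X + y) ^ X) (ℕP.^-monoˡ-≤ y (ℕP.+-monoˡ-≤ y (ℕP.m≤n+m y k))) ⟩
    (X + y) ^ X * (X + y) ^ y
  ≡⟨ sym (ℕP.^-distribˡ-+-* (X + y) X y) ⟩
    (X + y) ^ (X + y)
  ∎
  where
  open ℕP.≤-Reasoning
  X : ℕ
  X = k + y
  interchange : ∀ p q r → p * p * (q * r) ≡ p * q * (p * r)
  interchange = solve-∀
  double : ∀ y → 2 * y ≡ y + y
  double = solve-∀

balancedBound : ∀ c x y → c ≤ x → c ≤ y → 4 ^ c * (x ^ x * y ^ y) ≤ (x + y) ^ (x + y)
balancedBound c x y c≤x c≤y with ℕP.≤-total y x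
... | inj₁ y≤x = ≤-trans (ℕP.*-monoˡ-≤ _ (ℕP.^-monoʳ-≤ 4 c≤y)) (fourPowBound x y y≤x)
... | inj₂ x≤y = begin
    4 ^ c * (x ^ x * y ^ y)   ≡⟨ cong (4 ^ c *_) (ℕP.*-comm (x ^ x) (y ^ y)) ⟩
    4 ^ c * (y ^ y * x ^ x)   ≤⟨ ℕP.*-monoˡ-≤ _ (ℕP.^-monoʳ-≤ 4 c≤x) ⟩
    4 ^ x * (y ^ y * x ^ x)   ≤⟨ fourPowBound y x x≤y ⟩
    (y + x) ^ (y + x)         ≡⟨ cong (λ s → s ^ s) (ℕP.+-comm y x) ⟩
    (x + y) ^ (x + y)         ∎
  where open ℕP.≤-Reasoning

mergeBound : ∀ {E EL EU c} x y → E ≤ EL + EU + c → 4 ^ EL ≤ x ^ x → 4 ^ EU ≤ y ^ y →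
             c ≤ x → c ≤ y → 4 ^ E ≤ (x + y) ^ (x + y)
mergeBound {E} {EL} {EU} {c} x y E≤ boundL boundU c≤x c≤y = begin
    4 ^ E                        ≤⟨ ℕP.^-monoʳ-≤ 4 E≤ ⟩
    4 ^ (EL + EU + c)            ≡⟨ ℕP.^-distribˡ-+-* 4 (EL + EU) c ⟩
    4 ^ (EL + EU) * 4 ^ c        ≡⟨ cong (_* 4 ^ c) (ℕP.^-distribˡ-+-* 4 EL EU) ⟩
    4 ^ EL * 4 ^ EU * 4 ^ c      ≡⟨ ℕP.*-comm (4 ^ EL * 4 ^ EU) (4 ^ c) ⟩
    4 ^ c * (4 ^ EL * 4 ^ EU)    ≤⟨ ℕP.*-monoʳ-≤ (4 ^ c) (ℕP.*-mono-≤ boundL boundU) ⟩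
    4 ^ c * (x ^ x * y ^ y)      ≤⟨ balancedBound c x y c≤x c≤y ⟩
    (x + y) ^ (x + y)            ∎
  where open ℕP.≤-Reasoning

-- Σ_{x ∈ xs} f x.  Note that totalWeight A is definitionally sumOver weight A.
sumOver : {X : Set} → (X → ℕ) → List X → ℕ
sumOver f xs = sum (map f xs)

sumOver-+ : {X : Set} (f g : X → ℕ) (xs : List X) →
            sumOver (λ x → f x + g x) xs ≡ sumOver f xs + sumOver g xs
sumOver-+ f g [] = refl
sumOver-+ f g (x ∷ xs) =
  trans (cong (f x + g x +_) (sumOver-+ f g xs)) (interchange (f x) (g x) (sumOver f xs) (sumOver g xs))
  where
  interchange : ∀ a b c d → a + b + (c + d) ≡ a + c + (b + d)
  interchange = solve-∀

sumOver-cong : {X : Set} {f g : X → ℕ} (xs : List X) → (∀ {x} → x ∈ xs → f x ≡ g x) →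
               sumOver f xs ≡ sumOver g xs
sumOver-cong [] eq = refl
sumOver-cong (x ∷ xs) eq = cong₂ _+_ (eq (here refl)) (sumOver-cong xs (eq ∘ there))

sumOver-mono : {X : Set} {f g : X → ℕ} (xs : List X) → (∀ {x} → x ∈ xs → f x ≤ g x) →
               sumOver f xs ≤ sumOver g xs
sumOver-mono [] le = z≤n
sumOver-mono (x ∷ xs) le = +-mono-≤ (le (here refl)) (sumOver-mono xs (le ∘ there))

sumOver-zero : {X : Set} {f : X → ℕ} (xs : List X) → (∀ {x} → x ∈ xs → f x ≡ 0) → sumOver f xs ≡ 0
sumOver-zero [] eq = refl
sumOver-zero (x ∷ xs) eq = cong₂ _+_ (eq (here refl)) (sumOver-zero xs (eq ∘ there))

sumOver-≤length : {X : Set} {f : X → ℕ} (xs : List X) → (∀ {x} → x ∈ xs → f x ≤ 1) →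
                  sumOver f xs ≤ length xs
sumOver-≤length [] le = z≤n
sumOver-≤length (x ∷ xs) le = +-mono-≤ (le (here refl)) (sumOver-≤length xs (le ∘ there))

module Partition {X : Set} {P : Pred X 0ℓ} (P? : Decidable P) where

  length-partition : ∀ xs → length xs ≡ length (filter P? xs) + length (filter (∁? P?) xs)
  length-partition [] = refl
  length-partition (x ∷ xs) with P? x
  ... | yes _ = cong suc (length-partition xs)
  ... | no _ = trans (cong suc (length-partition xs)) (sym (ℕP.+-suc _ _))

  sumOver-partition : ∀ f xs → sumOver f xs ≡ sumOver f (filter P? xs) + sumOver f (filter (∁? P?) xs)
  sumOver-partition f [] = refl
  sumOver-partition f (x ∷ xs) with P? x
  ... | yes _ = trans (cong (f x +_) (sumOver-partition f xs)) (sym (ℕP.+-assoc (f x) _ _))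
  ... | no _ = trans (cong (f x +_) (sumOver-partition f xs))
                     (leftComm (f x) (sumOver f (filter P? xs)) (sumOver f (filter (∁? P?) xs)))
    where
    leftComm : ∀ a b c → a + (b + c) ≡ b + (a + c)
    leftComm = solve-∀

∑-mono : ∀ {n} {f g : Fin n → ℕ} → (∀ j → f j ≤ g j) → ∑ f ≤ ∑ g
∑-mono {zero} le = z≤n
∑-mono {suc n} le = +-mono-≤ (le zero) (∑-mono (le ∘ suc))

∑-zero : ∀ {n} (f : Fin n → ℕ) → (∀ j → f j ≡ 0) → ∑ f ≡ 0
∑-zero {n} f eq = trans (sum-cong-≗ eq) (sum-replicate-zero n)

∑-single : ∀ {n} (f : Fin n → ℕ) i → (∀ j → j ≢ i → f j ≡ 0) → ∑ f ≡ f i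
∑-single {suc n} f i eq = begin
    ∑ f                         ≡⟨ sum-remove f ⟩
    f i + ∑ (f ∘ punchIn i)     ≡⟨ cong (f i +_) (∑-zero (f ∘ punchIn i) (λ j → eq _ (punchInᵢ≢i i j))) ⟩
    f i + 0                     ≡⟨ ℕP.+-identityʳ (f i) ⟩
    f i                         ∎
  where open ≡-Reasoning

module Indicator {X : Set} (_≟_ : DecidableEquality X) where

  open import Data.List.Membership.DecPropositional _≟_ using (_∈?_)

  ind : X → List X → ℕ
  ind x A with x ∈? A
  ... | yes _ = 1
  ... | no _ = 0

  ind-yes : ∀ {x A} → x ∈ A → ind x A ≡ 1
  ind-yes {x} {A} x∈A with x ∈? A
  ... | yes _ = refl
  ... | no x∉A = contradiction x∈A x∉A

  ind-no : ∀ {x A} → x ∉ A → ind x A ≡ 0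
  ind-no {x} {A} x∉A with x ∈? A
  ... | yes x∈A = contradiction x∈A x∉A
  ... | no _ = refl

  ind-≤1 : ∀ x A → ind x A ≤ 1
  ind-≤1 x A with x ∈? A
  ... | yes _ = s≤s z≤n
  ... | no _ = z≤n

  ind-resp : ∀ {x A B} → (x ∈ A ⇔ x ∈ B) → ind x A ≡ ind x B
  ind-resp {x} {A} x∈A⇔x∈B with x ∈? A
  ... | yes x∈A = sym (ind-yes (Equivalence.to x∈A⇔x∈B x∈A))
  ... | no x∉A = sym (ind-no (x∉A ∘ Equivalence.from x∈A⇔x∈B))

  ind-remove : ∀ {x y A B} → x ≢ y → A ↭ y ∷ B → ind x A ≡ ind x B
  ind-remove {x} {y} {A} {B} x≢y A↭y∷B = ind-resp (mk⇔ toB (∈-resp-↭ (↭-sym A↭y∷B) ∘ there))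
    where
    toB : x ∈ A → x ∈ B
    toB x∈A with ∈-resp-↭ A↭y∷B x∈A
    ... | here x≡y = contradiction x≡y x≢y
    ... | there x∈B = x∈B

  ind-filter : {P : Pred X 0ℓ} (P? : Decidable P) → ∀ {x} A → P x → ind x (filter P? A) ≡ ind x A
  ind-filter P? A px = ind-resp (mk⇔ (proj₁ ∘ ∈-filter⁻ P? {xs = A}) (λ x∈A → ∈-filter⁺ P? x∈A px))

  ind-filter-out : {P : Pred X 0ℓ} (P? : Decidable P) → ∀ {x} A → ¬ P x → ind x (filter P? A) ≡ 0
  ind-filter-out P? A ¬px = ind-no (¬px ∘ proj₂ ∘ ∈-filter⁻ P? {xs = A})

  ind-partition : {P : Pred X 0ℓ} (P? : Decidable P) → ∀ x A →
                  ind x A ≡ ind x (filter P? A) + ind x (filter (∁? P?) A)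
  ind-partition P? x A with P? x
  ... | yes px = sym (trans (cong₂ _+_ (ind-filter P? A px) (ind-filter-out (∁? P?) A (λ ¬px → ¬px px)))
                            (ℕP.+-identityʳ (ind x A)))
  ... | no ¬px = sym (cong₂ _+_ (ind-filter-out P? A ¬px) (ind-filter (∁? P?) A ¬px))

  -- An injective map sends the distinct points of U to distinct points, so at most
  -- |L| of them land in L.
  injectiveHits : {Y : Set} (f : Y → X) → Injective _≡_ _≡_ f →
                  (U : List Y) (L : List X) → Unique U → sumOver (λ u → ind (f u) L) U ≤ length L
  injectiveHits f f-inj [] L _ = z≤n
  injectiveHits f f-inj (u ∷ U) L (u∉U ∷ U-unique) with f u ∈? L
  ... | no _ = injectiveHits f f-inj U L U-unique
  ... | yes fu∈L with ys , zs , refl ← ∈-∃++ fu∈L = begin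
      suc (sumOver (λ a → ind (f a) (ys ++ f u ∷ zs)) U)
    ≡⟨ cong suc (sumOver-cong U (λ a∈U → ind-remove (image-distinct a∈U) (shift (f u) ys zs))) ⟩
      suc (sumOver (λ a → ind (f a) (ys ++ zs)) U)
    ≤⟨ s≤s (injectiveHits f f-inj U (ys ++ zs) U-unique) ⟩
      suc (length (ys ++ zs))
    ≡⟨ sym (↭-length (shift (f u) ys zs)) ⟩
      length (ys ++ f u ∷ zs)
    ∎
    where
    open ℕP.≤-Reasoning
    image-distinct : ∀ {a} → a ∈ U → f a ≢ f u
    image-distinct a∈U fa≡fu = All.lookup u∉U a∈U (sym (f-inj fa≡fu))

Point : ℕ → Set
Point n = Vec ℤ n

lower : ∀ {n} → Fin n → Point n → Point n
lower j a = a [ j ]≔ ℤ.pred (lookup a j)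

raise : ∀ {n} → Fin n → Point n → Point n
raise j a = a [ j ]≔ ℤ.suc (lookup a j)

lower-at : ∀ {n} j (a : Point n) → lookup (lower j a) j ≡ ℤ.pred (lookup a j)
lower-at j a = lookup∘update j a _

lower-off : ∀ {n} {i j} (a : Point n) → i ≢ j → lookup (lower j a) i ≡ lookup a i
lower-off a i≢j = lookup∘update′ i≢j a _

pred<self : ∀ z → ℤ.pred z ℤ.< z
pred<self z = ℤP.i≤pred[j]⇒i<j ℤP.≤-refl

lower-≤ : ∀ {n} j i (a : Point n) → lookup (lower j a) i ℤ.≤ lookup a i
lower-≤ j i a with i ≟ᶠ j
... | yes refl = subst (ℤ._≤ lookup a i) (sym (lower-at i a)) (ℤP.<⇒≤ (pred<self (lookup a i)))
... | no i≢j = ℤP.≤-reflexive (lower-off a i≢j)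

lower-≢ : ∀ {n} j (a : Point n) → lower j a ≢ a
lower-≢ j a eq = ℤP.<⇒≢ (pred<self (lookup a j)) (trans (sym (lower-at j a)) (cong (λ v → lookup v j) eq))

raise∘lower : ∀ {n} j (a : Point n) → raise j (lower j a) ≡ a
raise∘lower j a = begin
    (a [ j ]≔ p) [ j ]≔ ℤ.suc (lookup (a [ j ]≔ p) j)
  ≡⟨ cong (λ z → (a [ j ]≔ p) [ j ]≔ ℤ.suc z) (lookup∘update j a p) ⟩
    (a [ j ]≔ p) [ j ]≔ ℤ.suc p                         ≡⟨ []≔-idempotent a j ⟩
    a [ j ]≔ ℤ.suc p                                    ≡⟨ cong (a [ j ]≔_) (ℤP.suc-pred (lookup a j)) ⟩
    a [ j ]≔ lookup a j                                 ≡⟨ []≔-lookup a j ⟩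
    a                                                   ∎
  where
  open ≡-Reasoning
  p : ℤ
  p = ℤ.pred (lookup a j)

lower-injective : ∀ {n} (j : Fin n) → Injective _≡_ _≡_ (lower j)
lower-injective j {a} {b} eq = trans (sym (raise∘lower j a)) (trans (cong (raise j) eq) (raise∘lower j b))

differingCoordinate : ∀ {n} {a b : Point n} → a ≢ b → ∃ λ i → lookup a i ≢ lookup b i
differingCoordinate {n} {a} {b} a≢b = ¬∀⟶∃¬ n _ (λ i → lookup a i ℤ.≟ lookup b i) (a≢b ∘ pointExt)
  where
  pointExt : (∀ i → lookup a i ≡ lookup b i) → a ≡ b
  pointExt eq = trans (sym (tabulate∘lookup a)) (trans (tabulate-cong eq) (tabulate∘lookup b))

-- Down-edges

module PointIndicator {n : ℕ} = Indicator {Point n} (≡-dec ℤ._≟_)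
open PointIndicator using (ind; ind-yes; ind-no; ind-≤1; ind-partition; injectiveHits)

downDegree : ∀ {n} → List (Point n) → Point n → ℕ
downDegree A a = ∑ (λ j → ind (lower j a) A)

edges : ∀ {n} → List (Point n) → ℕ
edges A = sumOver (downDegree A) A

IsoBound : ∀ {n} → List (Point n) → Set
IsoBound A = 4 ^ edges A ≤ length A ^ length A

edges-singleton : ∀ {n} (a : Point n) → edges (a ∷ []) ≡ 0
edges-singleton a = cong (_+ 0) (∑-zero (λ j → ind (lower j a) (a ∷ []))
                                         (λ j → ind-no (λ { (here eq) → lower-≢ j a eq ; (there ()) })))

module Cut {n : ℕ} (i : Fin n) (t : ℤ) where

  Below : Pred (Point n) 0ℓ
  Below x = lookup x i ℤ.< t

  below? : Decidable Below
  below? x = lookup x i ℤ.<? t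

  open Partition below?

  lowerPart upperPart : List (Point n) → List (Point n)
  lowerPart A = filter below? A
  upperPart A = filter (∁? below?) A

  in-lowerPart : ∀ {x} A → x ∈ lowerPart A → Below x
  in-lowerPart A = proj₂ ∘ ∈-filter⁻ below? {xs = A}

  in-upperPart : ∀ {x} A → x ∈ upperPart A → ¬ Below x
  in-upperPart A = proj₂ ∘ ∈-filter⁻ (∁? below?) {xs = A}

  below-lower : ∀ j {a} → Below a → Below (lower j a)
  below-lower j {a} = ℤP.≤-<-trans (lower-≤ j i a)

  above-lower : ∀ {j a} → j ≢ i → ¬ Below a → ¬ Below (lower j a)
  above-lower {j} {a} j≢i above below = above (subst (ℤ._< t) (lower-off a (j≢i ∘ sym)) below)

  -- The down-edges crossing the cut; each goes from the upper part along coordinate i.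
  crossing : List (Point n) → ℕ
  crossing A = sumOver (λ a → ind (lower i a) (lowerPart A)) (upperPart A)

  degree-split : ∀ A a → downDegree A a ≡ downDegree (lowerPart A) a + downDegree (upperPart A) a
  degree-split A a = trans (sum-cong-≗ (λ j → ind-partition below? (lower j a) A))
                           (∑-distrib-+ (λ j → ind (lower j a) (lowerPart A)) (λ j → ind (lower j a) (upperPart A)))

  edges-split : ∀ A → edges A ≡ edges (lowerPart A) + edges (upperPart A) + crossing A
  edges-split A = begin
      sumOver (downDegree A) A
    ≡⟨ sumOver-cong A (λ {a} _ → degree-split A a) ⟩
      sumOver (λ a → degL a + degU a) A
    ≡⟨ sumOver-+ degL degU A ⟩
      sumOver degL A + sumOver degU A
    ≡⟨ cong₂ _+_ (sumOver-partition degL A) (sumOver-partition degU A) ⟩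
      (edges L + sumOver degL U) + (sumOver degU L + edges U)
    ≡⟨ cong₂ (λ p q → (edges L + p) + (q + edges U)) upper-to-lower lower-to-upper ⟩
      (edges L + crossing A) + (0 + edges U)
    ≡⟨ rearrange (edges L) (crossing A) (edges U) ⟩
      edges L + edges U + crossing A
    ∎
    where
    open ≡-Reasoning
    L U : List (Point n)
    L = lowerPart A
    U = upperPart A
    degL degU : Point n → ℕ
    degL = downDegree L
    degU = downDegree U
    rearrange : ∀ a b c → (a + b) + (0 + c) ≡ a + c + b
    rearrange = solve-∀
    -- From above the cut, only the step along i can land below it.
    upper-to-lower : sumOver degL U ≡ crossing A
    upper-to-lower = sumOver-cong U λ {a} a∈U → ∑-single _ i λ j j≢i →
      ind-no (λ below∈L → above-lower {a = a} j≢i (in-upperPart A a∈U) (in-lowerPart A below∈L))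
    -- From below the cut, every step stays below it.
    lower-to-upper : sumOver degU L ≡ 0
    lower-to-upper = sumOver-zero L λ {a} a∈L → ∑-zero (λ j → ind (lower j a) U) λ j →
      ind-no (λ lowered∈U → in-upperPart A lowered∈U (below-lower j {a} (in-lowerPart A a∈L)))

  crossing-≤-upper : ∀ A → crossing A ≤ length (upperPart A)
  crossing-≤-upper A = sumOver-≤length (upperPart A) (λ {a} _ → ind-≤1 (lower i a) (lowerPart A))

  -- Distinct upper points have distinct lowerings, so at most |lowerPart A| of them cross.
  crossing-≤-lower : ∀ A → Unique A → crossing A ≤ length (lowerPart A)
  crossing-≤-lower A A-unique = injectiveHits (lower i) (lower-injective i) (upperPart A) (lowerPart A)
                                              (Unique.filter⁺ (∁? below?) A-unique)

  cutBound : ∀ A → Unique A → IsoBound (lowerPart A) → IsoBound (upperPart A) → IsoBound A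
  cutBound A A-unique boundL boundU =
    subst (λ s → 4 ^ edges A ≤ s ^ s) (sym (length-partition A))
      (mergeBound {EL = edges (lowerPart A)} {EU = edges (upperPart A)}
                  (length (lowerPart A)) (length (upperPart A)) (≤-reflexive (edges-split A))
                  boundL boundU (crossing-≤-lower A A-unique) (crossing-≤-upper A))

-- The edge-isoperimetric inequality in ℤⁿ

ShorterBounded : ∀ {n} → List (Point n) → Set
ShorterBounded {n} A = (B : List (Point n)) → length B < length A → Unique B → IsoBound B

-- Cutting between two points of A whose i-th coordinates differ leaves two nonempty,
-- hence shorter, parts.
cutBetween : ∀ {n} (A : List (Point n)) → Unique A → ∀ i {x y} → x ∈ A → y ∈ A →
             lookup x i ℤ.< lookup y i → ShorterBounded A → IsoBound A
cutBetween A A-unique i {x} {y} x∈A y∈A xᵢ<yᵢ shorterBounded =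
  cutBound A A-unique
    (shorterBounded (lowerPart A) (filter-notAll below? A (lose y∈A (ℤP.<-irrefl refl)))
                    (Unique.filter⁺ below? A-unique))
    (shorterBounded (upperPart A) (filter-notAll (∁? below?) A (lose x∈A (λ above → above xᵢ<yᵢ)))
                    (Unique.filter⁺ (∁? below?) A-unique))
  where open Cut i (lookup y i)

twoPointStep : ∀ {n} (a b : Point n) R →
               Unique (a ∷ b ∷ R) → ShorterBounded (a ∷ b ∷ R) → IsoBound (a ∷ b ∷ R)
twoPointStep a b R A-unique@((a≢b ∷ _) ∷ _) shorterBounded
  with i , aᵢ≢bᵢ ← differingCoordinate a≢b
  with ℤP.<-cmp (lookup a i) (lookup b i)
... | tri< aᵢ<bᵢ _ _ = cutBetween (a ∷ b ∷ R) A-unique i (here refl) (there (here refl)) aᵢ<bᵢ shorterBounded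
... | tri≈ _ aᵢ≡bᵢ _ = contradiction aᵢ≡bᵢ aᵢ≢bᵢ
... | tri> _ _ bᵢ<aᵢ = cutBetween (a ∷ b ∷ R) A-unique i (there (here refl)) (here refl) bᵢ<aᵢ shorterBounded

-- Strong induction on |A|, using a bound m on |A| as the measure.
isoperimetricBounded : ∀ {n} m (A : List (Point n)) → length A < m → Unique A → IsoBound A
isoperimetricBounded _ [] _ _ = ≤-refl
isoperimetricBounded _ (a ∷ []) _ _ = ≤-reflexive (cong (4 ^_) (edges-singleton a))
isoperimetricBounded (suc m) (a ∷ b ∷ R) (s≤s |A|≤m) A-unique =
  twoPointStep a b R A-unique (λ B |B|<|A| → isoperimetricBounded m B (ℕP.<-≤-trans |B|<|A| |A|≤m))

edgeIsoperimetric : ∀ {n} (A : List (Point n)) → Unique A → IsoBound A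
edgeIsoperimetric A = isoperimetricBounded (suc (length A)) A ≤-refl

-- Compressed sets: the weight is bounded by the down-degree

nonzero : ℤ → ℕ
nonzero z with z ℤ.≟ 0ℤ
... | yes _ = 0
... | no _ = 1

weight-as-sum : ∀ {n} (a : Point n) → weight a ≡ ∑ (λ j → nonzero (lookup a j))
weight-as-sum [] = refl
weight-as-sum (z ∷ a) with z ℤ.≟ 0ℤ
... | yes _ = weight-as-sum a
... | no _ = cong suc (weight-as-sum a)

fiberSize-lower : ∀ {n} j (a : Point n) A → fiberSize j (lower j a) A ≡ fiberSize j a A
fiberSize-lower j a A = cong (λ v → length (filter (λ b → ≡-dec ℤ._≟_ (b [ j ]≔ 0ℤ) v) A)) ([]≔-idempotent a j)

lower-valid : ∀ {n} {ord : Fin n → ℕ} j (a : Point n) → Valid ord a → 0ℤ ℤ.< lookup a j → Valid ord (lower j a)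
lower-valid {ord = ord} j a valid aⱼ>0 k with k ≟ᶠ j
... | yes refl = subst (InK (ord k)) (sym (lower-at k a)) (pred-inK (valid k))
  where
  pred-inK : InK (ord k) (lookup a k) → InK (ord k) (ℤ.pred (lookup a k))
  pred-inK (inj₁ infiniteOrder) = inj₁ infiniteOrder
  pred-inK (inj₂ (_ , aₖ<ord)) = inj₂ (ℤP.i<j⇒i≤pred[j] aⱼ>0 , ℤP.<-trans (pred<self _) aₖ<ord)
... | no k≢j = subst (InK (ord k)) (sym (lower-off a k≢j)) (valid k)

-- In a compressed set, lowering a nonzero coordinate of a member gives a member:
-- a − e_j lies in the same s_j-fibre as a, one step further down.
compressed-lower : ∀ {n} {ord : Fin n → ℕ} {A} {a : Point n} j → Compressed ord A → Valid ord a →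
                   a ∈ A → lookup a j ≢ 0ℤ → lower j a ∈ A
compressed-lower {A = A} {a} j compressed valid a∈A aⱼ≢0 =
  proj₂ (compressed j (lower j a) (lower-valid j a valid aⱼ>0)) (lowered-nonneg , lowered-in-fibre)
  where
  a-compressed : InCompression j A a
  a-compressed = proj₁ (compressed j a valid) a∈A
  aⱼ>0 : 0ℤ ℤ.< lookup a j
  aⱼ>0 = ℤP.≤∧≢⇒< (proj₁ a-compressed) (aⱼ≢0 ∘ sym)
  lowered-nonneg : 0ℤ ℤ.≤ lookup (lower j a) j
  lowered-nonneg = subst (0ℤ ℤ.≤_) (sym (lower-at j a)) (ℤP.i<j⇒i≤pred[j] aⱼ>0)
  lowered-in-fibre : lookup (lower j a) j ℤ.< ℤ.+ fiberSize j (lower j a) A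
  lowered-in-fibre = subst₂ ℤ._<_ (sym (lower-at j a)) (cong ℤ.+_ (sym (fiberSize-lower j a A)))
                            (ℤP.<-trans (pred<self _) (proj₂ a-compressed))

-- Every nonzero coordinate of a ∈ A gives a down-edge at a, so w(a) ≤ deg(a).
weight-≤-downDegree : ∀ {n} {ord : Fin n → ℕ} {A} {a : Point n} → Compressed ord A → Valid ord a →
                      a ∈ A → weight a ≤ downDegree A a
weight-≤-downDegree {A = A} {a} compressed valid a∈A =
  ≤-trans (≤-reflexive (weight-as-sum a)) (∑-mono nonzero-≤-ind)
  where
  nonzero-≤-ind : ∀ j → nonzero (lookup a j) ≤ ind (lower j a) A
  nonzero-≤-ind j with lookup a j ℤ.≟ 0ℤ
  ... | yes _ = z≤n
  ... | no aⱼ≢0 = ≤-reflexive (sym (ind-yes (compressed-lower j compressed valid a∈A aⱼ≢0)))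

totalWeight-≤-edges : ∀ {n} (ord : Fin n → ℕ) (A : List (Point n)) → All (Valid ord) A →
                      Compressed ord A → totalWeight A ≤ edges A
totalWeight-≤-edges ord A valid compressed =
  sumOver-mono A (λ a∈A → weight-≤-downDegree compressed (All.lookup valid a∈A) a∈A)

corollary3p3 : (n : ℕ) (ord : Fin n → ℕ) (A : List (Vec ℤ n)) →
    Unique A → All (Valid ord) A → A ≢ [] → Compressed ord A →
    2 ^ (2 * totalWeight A) ≤ length A ^ length A
corollary3p3 n ord A A-unique valid _ compressed = begin
    2 ^ (2 * totalWeight A)   ≡⟨ sym (ℕP.^-*-assoc 2 2 (totalWeight A)) ⟩
    4 ^ totalWeight A         ≤⟨ ℕP.^-monoʳ-≤ 4 (totalWeight-≤-edges ord A valid compressed) ⟩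
    4 ^ edges A               ≤⟨ edgeIsoperimetric A A-unique ⟩
    length A ^ length A       ∎
  where open ℕP.≤-Reasoning
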